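{- Let $p$ be an odd prime and let $m,n$ be natural numbers satisfying $mn\equiv 1 \pmod{p-1}$. Then the trinomials $X^{m+1}-2X+1$ and $X^{n+1}-2X+1$ in $\mathbb{Z}_p[X]$ have the same number of distinct roots in $\mathbb{Z}_p$.
   Context: $\mathbb{Z}_p$ denotes the field of residue classes of integers modulo the prime $p$, and $\mathbb{Z}_p[X]$ the ring of polynomials with coefficients in $\mathbb{Z}_p$; the coefficient $-2$ means $p-2$ in $\mathbb{Z}_p$. -}

module Defs where

open import Data.Nat using (ℕ; _+_; _*_; _∸_; _^_; _%_; NonZero)
open import Data.Nat.Primality using (Prime)
open import Data.Fin using (Fin; toℕ)
open import Data.List using (List; length; filter; allFin)
open import Relation.Binary.PropositionalEquality using (_≡_)
open import Data.Nat using (_≟_)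
open import Data.Product using (_×_)

-- Residue classes of ℤ_p are represented by Fin p (the canonical representatives 0..p-1).
-- Evaluation of the trinomial X^(k+1) - 2X + 1 in ℤ_p at x, where the coefficient -2 is
-- p-2 in ℤ_p (as in the paper), computed on representatives and reduced mod p.
trinomialValue : (p : ℕ) → .{{_ : NonZero p}} → ℕ → Fin p → ℕ
trinomialValue p k x = (toℕ x ^ (k + 1) + (p ∸ 2) * toℕ x + 1) % p

IsRoot : (p : ℕ) → .{{_ : NonZero p}} → ℕ → Fin p → Set
IsRoot p k x = trinomialValue p k x ≡ 0

numRoots : (p : ℕ) → .{{_ : NonZero p}} → ℕ → ℕ
numRoots p k = length (filter (λ x → trinomialValue p k x ≟ 0) (allFin p))

OddPrime : ℕ → Set
OddPrime p = Prime p × (p % 2 ≡ 1)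

module Submission where

-- The map  y ↦ y^(-m) = y^(m(p-2))
-- is a permutation of ℤ_p (its inverse is y ↦ y^(-n)), and it sends the roots of
-- T_m = X^(m+1) - 2X + 1 exactly onto the roots of T_n: for a root y ≠ 0 and
-- c = y^(-m) one has  y^(m+1) · T_n(c) = y^(m+1-m(n+1)) - 2y + y^(m+1) = T_m(y),
-- because y^(1-mn) = 1 by Fermat's little theorem.

open import Algebra.Bundles using (CommutativeMonoid)
import Algebra.Properties.CommutativeMonoid.Sum as MonoidSum
open import Data.Bool using (true; false; if_then_else_)
open import Data.Fin using (Fin; zero; suc; toℕ; fromℕ<)
open import Data.Fin.Permutation using (Permutation; permutation; _⟨$⟩ʳ_)
open import Data.Fin.Properties using (toℕ-injective; toℕ-fromℕ<; toℕ<n)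
open import Data.List using (length; filter; tabulate; allFin)
open import Data.Nat
open import Data.Nat.Coprimality using (prime⇒coprime; coprime-Bézout)
open import Data.Nat.DivMod
open import Data.Nat.GCD using (module Bézout)
open import Data.Nat.Primality using (Prime; prime⇒nonTrivial)
open import Data.Nat.Properties
open import Data.Nat.Tactic.RingSolver using (solve-∀)
open import Data.Product using (Σ; _,_)
open import Function.Bundles using (_⇔_; mk⇔; Equivalence)
open import Level using (0ℓ)
open import Relation.Binary.Bundles using (Setoid)
open import Relation.Binary.PropositionalEquality
import Relation.Binary.Reasoning.Setoid as SetoidReasoning
open import Relation.Nullary using (Dec; yes; no; does; ¬_)
open import Relation.Nullary.Decidable using (does-⇔)
open import Relation.Unary using (Pred; Decidable)
open import Defs

module Congruence (d : ℕ) .{{_ : NonZero d}} where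

  infix 4 _≈_
  -- a ≈ b means a ≡ b (mod d); the record wrapper lets Agda infer a and b.
  record _≈_ (a b : ℕ) : Set where
    constructor mk
    field remainders : a % d ≡ b % d
  open _≈_ public

  ≈-refl : ∀ {a} → a ≈ a
  ≈-refl = mk refl

  ≈-sym : ∀ {a b} → a ≈ b → b ≈ a
  ≈-sym (mk e) = mk (sym e)

  ≈-trans : ∀ {a b c} → a ≈ b → b ≈ c → a ≈ c
  ≈-trans (mk e) (mk f) = mk (trans e f)

  ≈-setoid : Setoid 0ℓ 0ℓ
  ≈-setoid = record
    { Carrier = ℕ ; _≈_ = _≈_
    ; isEquivalence = record { refl = ≈-refl ; sym = ≈-sym ; trans = ≈-trans } }

  module ≈-Reasoning = SetoidReasoning ≈-setoid

  ≡⇒≈ : ∀ {a b} → a ≡ b → a ≈ b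
  ≡⇒≈ e = mk (cong (_% d) e)

  mod≈ : ∀ a → a % d ≈ a
  mod≈ a = mk (m%n%n≡m%n a d)

  0%d≡0 : 0 % d ≡ 0
  0%d≡0 = m<n⇒m%n≡m (>-nonZero⁻¹ d)

  multiple≈0 : ∀ k → k * d ≈ 0
  multiple≈0 k = mk (trans (m*n%n≡0 k d) (sym 0%d≡0))

  d≈0 : d ≈ 0
  d≈0 = mk (trans (n%n≡0 d) (sym 0%d≡0))

  +-cong : ∀ {a b c e} → a ≈ b → c ≈ e → a + c ≈ b + e
  +-cong {a} {b} {c} {e} (mk a≡b) (mk c≡e) = mk (begin
    (a + c) % d          ≡⟨ %-distribˡ-+ a c d ⟩
    (a % d + c % d) % d  ≡⟨ cong₂ (λ u v → (u + v) % d) a≡b c≡e ⟩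
    (b % d + e % d) % d  ≡⟨ %-distribˡ-+ b e d ⟨
    (b + e) % d          ∎)
    where open ≡-Reasoning

  *-cong : ∀ {a b c e} → a ≈ b → c ≈ e → a * c ≈ b * e
  *-cong {a} {b} {c} {e} (mk a≡b) (mk c≡e) = mk (begin
    (a * c) % d              ≡⟨ %-distribˡ-* a c d ⟩
    (a % d * (c % d)) % d    ≡⟨ cong₂ (λ u v → (u * v) % d) a≡b c≡e ⟩
    (b % d * (e % d)) % d    ≡⟨ %-distribˡ-* b e d ⟨
    (b * e) % d              ∎)
    where open ≡-Reasoning

  +-congˡ : ∀ a {b c} → b ≈ c → a + b ≈ a + c
  +-congˡ a = +-cong (≈-refl {a})

  +-congʳ : ∀ c {a b} → a ≈ b → a + c ≈ b + c
  +-congʳ c a≈b = +-cong a≈b (≈-refl {c})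

  *-congˡ : ∀ a {b c} → b ≈ c → a * b ≈ a * c
  *-congˡ a = *-cong (≈-refl {a})

  *-congʳ : ∀ c {a b} → a ≈ b → a * c ≈ b * c
  *-congʳ c a≈b = *-cong a≈b (≈-refl {c})

  ^-cong : ∀ k {a b} → a ≈ b → a ^ k ≈ b ^ k
  ^-cong zero    a≈b = ≈-refl
  ^-cong (suc k) a≈b = *-cong a≈b (^-cong k a≈b)

  +-inverse : ∀ a → (d ∸ a % d) + a ≈ 0
  +-inverse a = begin
    (d ∸ a % d) + a      ≈⟨ +-congˡ (d ∸ a % d) (mod≈ a) ⟨
    (d ∸ a % d) + a % d  ≡⟨ m∸n+n≡m (<⇒≤ (m%n<n a d)) ⟩
    d                    ≈⟨ d≈0 ⟩
    0                    ∎
    where open ≈-Reasoning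

  +-cancelˡ : ∀ a {b c} → a + b ≈ a + c → b ≈ c
  +-cancelˡ a {b} {c} eq = begin
    b              ≈⟨ +-congʳ b (+-inverse a) ⟨
    (t + a) + b    ≡⟨ +-assoc t a b ⟩
    t + (a + b)    ≈⟨ +-congˡ t eq ⟩
    t + (a + c)    ≡⟨ +-assoc t a c ⟨
    (t + a) + c    ≈⟨ +-congʳ c (+-inverse a) ⟩
    c              ∎
    where
    open ≈-Reasoning
    t = d ∸ a % d

  -- Multiplication modulo d as a commutative monoid, so that finite products
  -- can be manipulated with the library's summation lemmas.
  *-commutativeMonoid : CommutativeMonoid 0ℓ 0ℓ
  *-commutativeMonoid = record
    { Carrier = ℕ ; _≈_ = _≈_ ; _∙_ = _*_ ; ε = 1
    ; isCommutativeMonoid = record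
      { isMonoid = record
        { isSemigroup = record
          { isMagma = record
            { isEquivalence = Setoid.isEquivalence ≈-setoid
            ; ∙-cong = *-cong }
          ; assoc = λ a b c → ≡⇒≈ (*-assoc a b c) }
        ; identity = (λ a → ≡⇒≈ (*-identityˡ a)) , (λ a → ≡⇒≈ (*-identityʳ a)) }
      ; comm = λ a b → ≡⇒≈ (*-comm a b) } }

  reduce : ℕ → Fin d
  reduce a = fromℕ< (m%n<n a d)

  toℕ-reduce : ∀ a → toℕ (reduce a) ≈ a
  toℕ-reduce a = ≈-trans (≡⇒≈ (toℕ-fromℕ< (m%n<n a d))) (mod≈ a)

  reduce-unique : ∀ {a} i → a ≈ toℕ i → reduce a ≡ i
  reduce-unique {a} i (mk a≡i) = toℕ-injective (begin
    toℕ (reduce a)  ≡⟨ toℕ-fromℕ< (m%n<n a d) ⟩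
    a % d           ≡⟨ a≡i ⟩
    toℕ i % d       ≡⟨ m<n⇒m%n≡m (toℕ<n i) ⟩
    toℕ i           ∎)
    where open ≡-Reasoning

  Respects≈ : (ℕ → ℕ) → Set
  Respects≈ f = ∀ {a b} → a ≈ b → f a ≈ f b

  lift : (ℕ → ℕ) → Fin d → Fin d
  lift f i = reduce (f (toℕ i))

  lift-inverse : ∀ {f g} → Respects≈ g → (∀ a → g (f a) ≈ a) →
                 ∀ i → lift g (lift f i) ≡ i
  lift-inverse g-resp g∘f≈id i =
    reduce-unique i (≈-trans (g-resp (toℕ-reduce _)) (g∘f≈id (toℕ i)))

  liftPermutation : ∀ f g → Respects≈ f → Respects≈ g →
                    (∀ a → g (f a) ≈ a) → (∀ a → f (g a) ≈ a) → Permutation d d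
  liftPermutation f g f-resp g-resp g∘f≈id f∘g≈id =
    permutation (lift f) (lift g) (lift-inverse f-resp f∘g≈id) (lift-inverse g-resp g∘f≈id)

module PrimeField (q : ℕ) (p-prime : Prime (suc q)) where

  open Congruence (suc q)
  open MonoidSum *-commutativeMonoid using (sum; sum-permute; sum-cong-≋)

  p : ℕ
  p = suc q

  NonzeroResidue : ℕ → Set
  NonzeroResidue x = ¬ x ≈ 0

  1≉0 : NonzeroResidue 1
  1≉0 (mk 1≡0) = 0≢1+n (trans (sym 1≡0) (m<n⇒m%n≡m 1<p))
    where
    1<p : 1 < p
    1<p = nonTrivial⇒n>1 p {{prime⇒nonTrivial p-prime}}

  -- (p - 1)² ≡ 1, i.e. (-1)² = 1; used to invert the sign in Bézout's identity.
  q*q≈1 : q * q ≈ 1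
  q*q≈1 = +-cancelˡ q (begin
    q + q * q  ≡⟨ *-suc q q ⟨
    q * p      ≈⟨ multiple≈0 q ⟩
    0          ≈⟨ d≈0 ⟨
    p          ≡⟨ +-comm 1 q ⟩
    q + 1      ∎)
    where open ≈-Reasoning

  -- Every nonzero residue is invertible: Bézout's identity for x mod p and p.
  inverse : ∀ x → NonzeroResidue x → Σ ℕ λ y → x * y ≈ 1
  inverse x x≉0 with coprime-Bézout (prime⇒coprime p-prime {{≢-nonZero u≢0}} (m%n<n x p))
    where
    u≢0 : x % p ≢ 0
    u≢0 e = x≉0 (mk e)
  ... | Bézout.-+ a b 1+ap≡bu = b , (begin
    x * b        ≈⟨ *-congʳ b (mod≈ x) ⟨
    x % p * b    ≡⟨ *-comm (x % p) b ⟩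
    b * (x % p)  ≡⟨ 1+ap≡bu ⟨
    1 + a * p    ≈⟨ +-congˡ 1 (multiple≈0 a) ⟩
    1            ∎)
    where open ≈-Reasoning
  ... | Bézout.+- a b 1+bu≡ap = b * q , (begin
    x * (b * q)  ≡⟨ *-assoc x b q ⟨
    x * b * q    ≈⟨ *-congʳ q xb≈q ⟩
    q * q        ≈⟨ q*q≈1 ⟩
    1            ∎)
    where
    open ≈-Reasoning
    xb≈q : x * b ≈ q
    xb≈q = +-cancelˡ 1 (begin
      1 + x * b        ≈⟨ +-congˡ 1 (*-congʳ b (mod≈ x)) ⟨
      1 + x % p * b    ≡⟨ cong (1 +_) (*-comm (x % p) b) ⟩
      1 + b * (x % p)  ≡⟨ 1+bu≡ap ⟩
      a * p            ≈⟨ multiple≈0 a ⟩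
      0                ≈⟨ d≈0 ⟨
      1 + q            ∎)

  *-cancelʳ : ∀ {a b c} → NonzeroResidue c → a * c ≈ b * c → a ≈ b
  *-cancelʳ {a} {b} {c} c≉0 ac≈bc with inverse c c≉0
  ... | y , cy≈1 = begin
    a            ≡⟨ *-identityʳ a ⟨
    a * 1        ≈⟨ *-congˡ a cy≈1 ⟨
    a * (c * y)  ≡⟨ *-assoc a c y ⟨
    a * c * y    ≈⟨ *-congʳ y ac≈bc ⟩
    b * c * y    ≡⟨ *-assoc b c y ⟩
    b * (c * y)  ≈⟨ *-congˡ b cy≈1 ⟩
    b * 1        ≡⟨ *-identityʳ b ⟩
    b            ∎
    where open ≈-Reasoning

  *-nonzero : ∀ {a b} → NonzeroResidue a → NonzeroResidue b → NonzeroResidue (a * b)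
  *-nonzero {a} {b} a≉0 b≉0 ab≈0 = a≉0 (*-cancelʳ b≉0 ab≈0)

  ^-nonzero : ∀ {x} k → NonzeroResidue x → NonzeroResidue (x ^ k)
  ^-nonzero zero    x≉0 = 1≉0
  ^-nonzero (suc k) x≉0 = *-nonzero x≉0 (^-nonzero k x≉0)

  product-nonzero : ∀ {k} (g : Fin k → ℕ) → (∀ i → NonzeroResidue (g i)) → NonzeroResidue (sum g)
  product-nonzero {zero}  g g≉0 = 1≉0
  product-nonzero {suc k} g g≉0 = *-nonzero (g≉0 zero) (product-nonzero (λ i → g (suc i)) (λ i → g≉0 (suc i)))

  product-scale : ∀ x {k} (g : Fin k → ℕ) → sum (λ i → x * g i) ≈ x ^ k * sum g
  product-scale x {zero}  g = ≈-refl
  product-scale x {suc k} g = begin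
    x * g zero * sum (λ i → x * g (suc i))   ≈⟨ *-congˡ (x * g zero) (product-scale x (λ i → g (suc i))) ⟩
    x * g zero * (x ^ k * sum (λ i → g (suc i)))  ≡⟨ interchange x (g zero) (x ^ k) _ ⟩
    x * x ^ k * (g zero * sum (λ i → g (suc i)))  ∎
    where
    open ≈-Reasoning
    interchange : ∀ a b c e → a * b * (c * e) ≡ a * c * (b * e)
    interchange = solve-∀

  multiplication : ∀ x y → x * y ≈ 1 → Permutation p p
  multiplication x y xy≈1 =
    liftPermutation (x *_) (y *_) (*-congˡ x) (*-congˡ y) (cancel y x yx≈1) (cancel x y xy≈1)
    where
    yx≈1 : y * x ≈ 1
    yx≈1 = ≈-trans (≡⇒≈ (*-comm y x)) xy≈1
    cancel : ∀ u v → u * v ≈ 1 → ∀ a → u * (v * a) ≈ a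
    cancel u v uv≈1 a = begin
      u * (v * a)  ≡⟨ *-assoc u v a ⟨
      u * v * a    ≈⟨ *-congʳ a uv≈1 ⟩
      1 * a        ≡⟨ *-identityˡ a ⟩
      a            ∎
      where open ≈-Reasoning

  nonzeroResidue : Fin q → ℕ
  nonzeroResidue j = suc (toℕ j)

  nonzeroResidue-nonzero : ∀ j → NonzeroResidue (nonzeroResidue j)
  nonzeroResidue-nonzero j (mk e) = 0≢1+n (trans (sym e) (m<n⇒m%n≡m (s≤s (toℕ<n j))))

  -- The representative of a residue, with 0 replaced by 1; its product over ℤ_p is
  -- the (nonzero) product of the nonzero residues.
  nonzeroRep : Fin p → ℕ
  nonzeroRep zero    = 1
  nonzeroRep (suc j) = nonzeroResidue j

  nonzeroRep-toℕ : (i : Fin p) → NonzeroResidue (toℕ i) → nonzeroRep i ≡ toℕ i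
  nonzeroRep-toℕ zero    0≉0 with () ← 0≉0 ≈-refl
  nonzeroRep-toℕ (suc j) _ = refl

  -- Fermat's little theorem: multiplying all nonzero residues by x permutes them,
  -- so their product F satisfies F ≡ x^(p-1) F, and F can be cancelled.
  fermat : ∀ x → NonzeroResidue x → x ^ q ≈ 1
  fermat x x≉0 with inverse x x≉0
  ... | y , xy≈1 = ≈-sym (*-cancelʳ F≉0 (begin
    1 * F                                    ≡⟨⟩
    sum nonzeroRep                           ≈⟨ sum-permute nonzeroRep π ⟩
    sum (λ i → nonzeroRep (π ⟨$⟩ʳ i))          ≡⟨ cong (λ i → nonzeroRep i * sum (λ j → nonzeroRep (π ⟨$⟩ʳ suc j))) π0≡0 ⟩
    1 * sum (λ j → nonzeroRep (π ⟨$⟩ʳ suc j))  ≈⟨ *-congˡ 1 (sum-cong-≋ image-suc) ⟩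
    1 * sum (λ j → x * nonzeroResidue j)     ≈⟨ *-congˡ 1 (product-scale x nonzeroResidue) ⟩
    1 * (x ^ q * F)                          ≡⟨ *-identityˡ _ ⟩
    x ^ q * F                                ∎))
    where
    open ≈-Reasoning
    π = multiplication x y xy≈1
    F = sum nonzeroResidue
    F≉0 : NonzeroResidue F
    F≉0 = product-nonzero nonzeroResidue nonzeroResidue-nonzero
    π0≡0 : π ⟨$⟩ʳ zero ≡ zero
    π0≡0 = reduce-unique zero (≡⇒≈ (*-zeroʳ x))
    image-suc : ∀ j → nonzeroRep (π ⟨$⟩ʳ suc j) ≈ x * nonzeroResidue j
    image-suc j = ≈-trans (≡⇒≈ (nonzeroRep-toℕ _ image≉0)) (toℕ-reduce _)
      where
      image≉0 : NonzeroResidue (toℕ (π ⟨$⟩ʳ suc j))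
      image≉0 image≈0 = *-nonzero x≉0 (nonzeroResidue-nonzero j) (≈-trans (≈-sym (toℕ-reduce _)) image≈0)

  fermat-multiple : ∀ x → NonzeroResidue x → ∀ k → x ^ (k * q) ≈ 1
  fermat-multiple x x≉0 k = begin
    x ^ (k * q)  ≡⟨ cong (x ^_) (*-comm k q) ⟩
    x ^ (q * k)  ≡⟨ ^-*-assoc x q k ⟨
    (x ^ q) ^ k  ≈⟨ ^-cong k (fermat x x≉0) ⟩
    1 ^ k        ≡⟨ ^-zeroˡ k ⟩
    1            ∎
    where open ≈-Reasoning

  fermat-power : ∀ x k → x ^ (1 + k * q) ≈ x
  fermat-power x k with x % p ≟ 0
  ... | yes x%p≡0 = ≈-trans (*-congʳ (x ^ (k * q)) x≈0) (≈-sym x≈0)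
    where
    x≈0 : x ≈ 0
    x≈0 = mk (trans x%p≡0 (sym 0%d≡0))
  ... | no x%p≢0 = begin
    x * x ^ (k * q)  ≈⟨ *-congˡ x (fermat-multiple x x≉0 k) ⟩
    x * 1            ≡⟨ *-identityʳ x ⟩
    x                ∎
    where
    open ≈-Reasoning
    x≉0 : NonzeroResidue x
    x≉0 x≈0 = x%p≢0 (trans (remainders x≈0) 0%d≡0)

module Counting where

  open MonoidSum +-0-commutativeMonoid using (sum; sum-permute; sum-cong-≗)

  indicator : ∀ {A : Set} → Dec A → ℕ
  indicator a? = if does a? then 1 else 0

  length-filter : ∀ {A : Set} {P : Pred A 0ℓ} (P? : Decidable P) {n} (g : Fin n → A) →
                  length (filter P? (tabulate g)) ≡ sum (λ i → indicator (P? (g i)))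
  length-filter P? {zero}  g = refl
  length-filter P? {suc n} g with does (P? (g zero))
  ... | true  = cong suc (length-filter P? (λ i → g (suc i)))
  ... | false = length-filter P? (λ i → g (suc i))

  count-permute : ∀ {n} {P Q : Pred (Fin n) 0ℓ} (P? : Decidable P) (Q? : Decidable Q)
                  (π : Permutation n n) → (∀ i → P (π ⟨$⟩ʳ i) ⇔ Q i) →
                  length (filter P? (allFin n)) ≡ length (filter Q? (allFin n))
  count-permute P? Q? π P∘π⇔Q = begin
    length (filter P? (allFin _))          ≡⟨ length-filter P? (λ i → i) ⟩
    sum (λ i → indicator (P? i))           ≡⟨ sum-permute (λ i → indicator (P? i)) π ⟩
    sum (λ i → indicator (P? (π ⟨$⟩ʳ i)))  ≡⟨ sum-cong-≗ same-indicator ⟩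
    sum (λ i → indicator (Q? i))           ≡⟨ length-filter Q? (λ i → i) ⟨
    length (filter Q? (allFin _))          ∎
    where
    open ≡-Reasoning
    same-indicator : ∀ i → indicator (P? (π ⟨$⟩ʳ i)) ≡ indicator (Q? i)
    same-indicator i = cong (λ b → if b then 1 else 0) (does-⇔ (P∘π⇔Q i) (P? _) (Q? i))

module Trinomial (r : ℕ) (p-prime : Prime (3 + r)) where

  q : ℕ
  q = 2 + r

  open Congruence (3 + r)
  open PrimeField q p-prime

  -- X^(k+1) - 2X + 1 on representatives, with -2 written as p - 2 = 1 + r.
  trinomial : ℕ → ℕ → ℕ
  trinomial k y = y ^ (k + 1) + suc r * y + 1

  trinomial-cong : ∀ k → Respects≈ (trinomial k)
  trinomial-cong k a≈b = +-congʳ 1 (+-cong (^-cong (k + 1) a≈b) (*-congˡ (suc r) a≈b))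

  isRoot? : ∀ k → Decidable (IsRoot p k)
  isRoot? k x = trinomialValue p k x ≟ 0

  root-of-reduce : ∀ k a → IsRoot p k (reduce a) ⇔ trinomial k a ≈ 0
  root-of-reduce k a = mk⇔
    (λ root → ≈-trans (trinomial-cong k (≈-sym (toℕ-reduce a))) (mk root))
    (λ a-root → remainders (≈-trans (trinomial-cong k (toℕ-reduce a)) a-root))

  roots-nonzero : ∀ k y → trinomial k y ≈ 0 → NonzeroResidue y
  roots-nonzero k y y-root y≈0 = 1≉0 (begin
    1              ≡⟨ trinomial-at-0 ⟨
    trinomial k 0  ≈⟨ trinomial-cong k y≈0 ⟨
    trinomial k y  ≈⟨ y-root ⟩
    0              ∎)
    where
    open ≈-Reasoning
    trinomial-at-0 : trinomial k 0 ≡ 1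
    trinomial-at-0 = cong₂ (λ a b → a + b + 1)
      (cong (0 ^_) (+-comm k 1)) (*-zeroʳ (suc r))

  record InverseExponents (m n : ℕ) : Set where
    constructor inverseExponents
    field
      quotient : ℕ
      product  : m * n ≡ 1 + quotient * q

  inverseExponents-sym : ∀ {m n} → InverseExponents m n → InverseExponents n m
  inverseExponents-sym {m} {n} (inverseExponents K mn≡) = inverseExponents K (trans (*-comm n m) mn≡)

  -- y ↦ y^(-k), written as y^(k(p-2)) since p - 2 ≡ -1 (mod p - 1).
  reflect : ℕ → ℕ → ℕ
  reflect k y = y ^ (k * suc r)

  reflect-cong : ∀ k → Respects≈ (reflect k)
  reflect-cong k = ^-cong (k * suc r)

  reflect-involutive : ∀ {m n} → InverseExponents m n → ∀ y → reflect n (reflect m y) ≈ y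
  reflect-involutive {m} {n} (inverseExponents K mn≡) y = begin
    (y ^ (m * suc r)) ^ (n * suc r)    ≡⟨ ^-*-assoc y (m * suc r) (n * suc r) ⟩
    y ^ (m * suc r * (n * suc r))      ≡⟨ cong (y ^_) exponent ⟩
    y ^ (1 + (K + r + K * r * q) * q)  ≈⟨ fermat-power y (K + r + K * r * q) ⟩
    y                                  ∎
    where
    open ≈-Reasoning
    regroup : ∀ m n r → m * suc r * (n * suc r) ≡ (m * n) * (suc r * suc r)
    regroup = solve-∀
    square : ∀ K r → (1 + K * suc (suc r)) * (suc r * suc r)
                     ≡ 1 + (K + r + K * r * suc (suc r)) * suc (suc r)
    square = solve-∀
    exponent : m * suc r * (n * suc r) ≡ 1 + (K + r + K * r * q) * q
    exponent = trans (regroup m n r) (trans (cong (_* (suc r * suc r)) mn≡) (square K r))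

  scaled-trinomial : ∀ n A c y → A * c ^ (n + 1) ≈ 1 → A * c ≈ y →
                     A * trinomial n c ≈ A + suc r * y + 1
  scaled-trinomial n A c y Acⁿ⁺¹≈1 Ac≈y = begin
    A * trinomial n c                      ≡⟨ distribute A (c ^ (n + 1)) (suc r) c ⟩
    A * c ^ (n + 1) + suc r * (A * c) + A  ≈⟨ +-congʳ A (+-cong Acⁿ⁺¹≈1 (*-congˡ (suc r) Ac≈y)) ⟩
    1 + suc r * y + A                      ≡⟨ swap A (suc r * y) ⟩
    A + suc r * y + 1                      ∎
    where
    open ≈-Reasoning
    distribute : ∀ a b s c → a * (b + s * c + 1) ≡ a * b + s * (a * c) + a
    distribute = solve-∀
    swap : ∀ a b → 1 + b + a ≡ a + b + 1
    swap = solve-∀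

  -- For mn = 1 + K(p-1), y ↦ y^(-m) maps roots of T_m to roots of T_n,
  -- because y^(m+1) · T_n(y^(-m)) ≡ T_m(y) and y ≢ 0.
  reflect-root : ∀ {m n} → InverseExponents m n → ∀ y →
                 trinomial m y ≈ 0 → trinomial n (reflect m y) ≈ 0
  reflect-root {m} {n} (inverseExponents K mn≡) y y-root = *-cancelʳ A≉0 (begin
    trinomial n c * A  ≡⟨ *-comm (trinomial n c) A ⟩
    A * trinomial n c  ≈⟨ scaled-trinomial n A c y Acⁿ⁺¹≈1 Ac≈y ⟩
    trinomial m y      ≈⟨ y-root ⟩
    0                  ∎)
    where
    open ≈-Reasoning
    c = reflect m y
    A = y ^ (m + 1)
    y≉0 : NonzeroResidue y
    y≉0 = roots-nonzero m y y-root
    A≉0 : NonzeroResidue A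
    A≉0 = ^-nonzero (m + 1) y≉0
    expand : ∀ m n r → (m + 1) + m * suc r * (n + 1)
                       ≡ (m * n) * suc r + ((m + 1) + m * suc r)
    expand = solve-∀
    collect : ∀ m K r → (1 + K * suc (suc r)) * suc r + ((m + 1) + m * suc r)
                        ≡ (1 + m + K * suc r) * suc (suc r)
    collect = solve-∀
    collect₁ : ∀ m r → (m + 1) + m * suc r ≡ 1 + m * suc (suc r)
    collect₁ = solve-∀
    Acⁿ⁺¹≈1 : A * c ^ (n + 1) ≈ 1
    Acⁿ⁺¹≈1 = begin
      A * c ^ (n + 1)                                    ≡⟨ cong (A *_) (^-*-assoc y (m * suc r) (n + 1)) ⟩
      A * y ^ (m * suc r * (n + 1))                      ≡⟨ ^-distribˡ-+-* y (m + 1) _ ⟨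
      y ^ ((m + 1) + m * suc r * (n + 1))                ≡⟨ cong (y ^_) (expand m n r) ⟩
      y ^ ((m * n) * suc r + ((m + 1) + m * suc r))      ≡⟨ cong (λ e → y ^ (e * suc r + ((m + 1) + m * suc r))) mn≡ ⟩
      y ^ ((1 + K * q) * suc r + ((m + 1) + m * suc r))  ≡⟨ cong (y ^_) (collect m K r) ⟩
      y ^ ((1 + m + K * suc r) * q)                      ≈⟨ fermat-multiple y y≉0 (1 + m + K * suc r) ⟩
      1                                                  ∎
    Ac≈y : A * c ≈ y
    Ac≈y = begin
      A * c                      ≡⟨ ^-distribˡ-+-* y (m + 1) (m * suc r) ⟨
      y ^ ((m + 1) + m * suc r)  ≡⟨ cong (y ^_) (collect₁ m r) ⟩
      y ^ (1 + m * q)            ≈⟨ fermat-power y m ⟩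
      y                          ∎

  reflection : ∀ {m n} → InverseExponents m n → Permutation p p
  reflection {m} {n} m⁻¹≡n = liftPermutation (reflect n) (reflect m) (reflect-cong n) (reflect-cong m)
    (reflect-involutive (inverseExponents-sym m⁻¹≡n)) (reflect-involutive m⁻¹≡n)

  reflection-roots : ∀ {m n} (m⁻¹≡n : InverseExponents m n) y →
                     IsRoot p m (reflection m⁻¹≡n ⟨$⟩ʳ y) ⇔ IsRoot p n y
  reflection-roots {m} {n} m⁻¹≡n y = mk⇔
    (λ image-root → remainders (begin
      trinomial n (toℕ y)                          ≈⟨ trinomial-cong n (reflect-involutive n⁻¹≡m (toℕ y)) ⟨
      trinomial n (reflect m (reflect n (toℕ y)))  ≈⟨ reflect-root m⁻¹≡n _ (Equivalence.to (root-of-reduce m _) image-root) ⟩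
      0                                            ∎))
    (λ y-root → Equivalence.from (root-of-reduce m _) (reflect-root n⁻¹≡m (toℕ y) (mk y-root)))
    where
    open ≈-Reasoning
    n⁻¹≡m = inverseExponents-sym m⁻¹≡n

  equal-root-counts : ∀ {m n} → InverseExponents m n → numRoots p m ≡ numRoots p n
  equal-root-counts {m} {n} m⁻¹≡n =
    Counting.count-permute (isRoot? m) (isRoot? n) (reflection m⁻¹≡n) (reflection-roots m⁻¹≡n)

mainTheorem1 : (p m n : ℕ) → .{{_ : NonZero p}} → .{{_ : NonZero (p ∸ 1)}} →
    OddPrime p → (m * n) % (p ∸ 1) ≡ 1 % (p ∸ 1) →
    numRoots p m ≡ numRoots p n
mainTheorem1 0 m n (_ , ())
mainTheorem1 1 m n (p-prime , _) with () ← prime⇒nonTrivial p-prime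
mainTheorem1 2 m n (_ , ())
mainTheorem1 (suc (suc (suc r))) m n (p-prime , _) mn%q≡1 =
  Trinomial.equal-root-counts r p-prime {m} {n} (Trinomial.inverseExponents (m * n / q) (begin
    m * n                          ≡⟨ m≡m%n+[m/n]*n (m * n) q ⟩
    (m * n) % q + (m * n / q) * q  ≡⟨ cong (_+ (m * n / q) * q) mn%q≡1 ⟩
    1 + (m * n / q) * q            ∎))
  where
  open ≡-Reasoning
  q = suc (suc r)
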